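{- Let $G$ be a finite simple graph. Then there exists a proper vertex coloring $c'$ of $G$ using colors from $\{1,\dots,\chi(G)+3\}$ such that the set $B_{c'}$ is an independent set, where $B_{c'}$ is the set of vertices $v$ with $d(v)\ge 2$ all of whose neighbours receive the same color under $c'$.
   Context: $\chi(G)$ is the chromatic number of $G$; $d(v)$ is the degree of $v$. -}

module Defs where

open import Data.Nat using (ℕ; _≤_)
open import Data.Fin using (Fin)
open import Data.List using (length; filter)
open import Data.List.Base using (allFin)
open import Data.Product using (Σ; ∃; _×_)
open import Relation.Nullary using (¬_; Dec)
open import Relation.Binary.PropositionalEquality using (_≡_)
open import Level using (0ℓ)

record SimpleGraph (n : ℕ) : Set₁ where
  field
    Adj      : Fin n → Fin n → Set
    adj?     : (u v : Fin n) → Dec (Adj u v)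
    sym      : ∀ {u v} → Adj u v → Adj v u
    irrefl   : ∀ {v} → ¬ Adj v v
open SimpleGraph public

degree : ∀ {n} (G : SimpleGraph n) → Fin n → ℕ
degree {n} G v = length (filter (adj? G v) (allFin n))

Proper : ∀ {n} {C : Set} (G : SimpleGraph n) → (Fin n → C) → Set
Proper G c = ∀ u v → Adj G u v → ¬ (c u ≡ c v)

Colorable : ∀ {n} (G : SimpleGraph n) → ℕ → Set
Colorable {n} G k = Σ (Fin n → Fin k) (Proper G)

IsChromaticNumber : ∀ {n} (G : SimpleGraph n) → ℕ → Set
IsChromaticNumber G k = Colorable G k × (∀ m → Colorable G m → k ≤ m)

InB : ∀ {n} {C : Set} (G : SimpleGraph n) → (Fin n → C) → Fin n → Set
InB G c v = 2 ≤ degree G v × (∀ u w → Adj G v u → Adj G v w → c u ≡ c w)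

Independent : ∀ {n} (G : SimpleGraph n) → (Fin n → Set) → Set
Independent G S = ∀ u v → S u → S v → ¬ Adj G u v

module Submission where

-- Start from any proper colouring c with k colours.  Choose, greedily, a maximal independent set S, and inside
-- S a maximal set Q of vertices no two of which share a neighbour outside
-- S.  Call a vertex v ∉ S saturated if all its neighbours lie in S ∖ Q.
-- The new colouring gives Q the colour Z, S ∖ Q the colour X, saturated
-- vertices the colour Y, and keeps c elsewhere.  It is proper, and two
-- adjacent vertices u, v of B lead to a contradiction:
--   * u, v ∈ S is impossible (S is independent);
--   * u, v ∉ S: u sees a vertex of S (maximality), which gets a colour of
--     S, unlike v;
--   * u ∈ S, v ∉ S: according as u ∈ Q, or v saturated, or neither, one
--     contradicts the choice of Q, its maximality, or the colour of u.

open import Defs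
open import Data.Nat using (ℕ; _+_; _≤_; s≤s)
open import Data.Fin using (Fin; zero; suc; join; splitAt)
open import Data.Fin.Properties using (_≟_; all?; any?; ¬∀⟶∃¬; splitAt-join)
open import Data.Product using (Σ; _×_; _,_; proj₁; proj₂; ∃-syntax)
open import Data.Sum using (_⊎_; inj₁; inj₂)
open import Data.Empty using (⊥; ⊥-elim)
open import Data.Unit using (⊤; tt)
open import Data.List using (List; []; _∷_; filter; length)
open import Data.List.Base using (allFin)
import Data.List.Relation.Unary.Any as Any
open import Data.List.Relation.Unary.Any using (here; there)
open import Data.List.Membership.Propositional using (_∈_; _∉_; find; lose)
open import Data.List.Membership.Propositional.Properties using (∈-filter⁻; ∈-allFin)
import Data.List.Membership.DecPropositional as DecMembership
open import Data.List.Relation.Unary.Unique.Propositional using (Unique)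
open import Data.List.Relation.Unary.Unique.Propositional.Properties using (allFin⁺; filter⁺)
open import Data.List.Relation.Unary.AllPairs using (_∷_)
open import Data.List.Relation.Unary.All using (_∷_)
open import Function using (_∘_)
open import Function.Definitions using (Injective)
open import Relation.Nullary using (¬_; Dec; yes; no)
open import Relation.Nullary.Decidable using (_×-dec_; _→-dec_; ¬?)
open import Relation.Unary using (Decidable)
open import Relation.Binary.PropositionalEquality using (_≡_; _≢_; refl; trans; cong; module ≡-Reasoning)
  renaming (sym to ≡-sym)

record MaximalFreeSubset {n : ℕ} (A : Fin n → Set) (Conflict : Fin n → Fin n → Set) : Set₁ where
  field
    Member        : Fin n → Set
    member?       : Decidable Member
    member⇒A      : ∀ {x} → Member x → A x
    conflict-free : ∀ {x y} → Member x → Member y → x ≢ y → ¬ Conflict x y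
    maximal       : ∀ {x} → A x → ¬ Member x → ∃[ m ] Member m × Conflict m x

module Greedy {n : ℕ} {A : Fin n → Set} (A? : Decidable A)
  {Conflict : Fin n → Fin n → Set} (conflict? : ∀ x y → Dec (Conflict x y))
  (conflict-sym : ∀ {x y} → Conflict x y → Conflict y x) where

  record Scan (xs : List (Fin n)) : Set where
    field
      chosen  : List (Fin n)
      sound   : ∀ {x} → x ∈ chosen → A x
      free    : ∀ {x y} → x ∈ chosen → y ∈ chosen → x ≢ y → ¬ Conflict x y
      blocked : ∀ {x} → x ∈ xs → A x → x ∉ chosen → ∃[ m ] m ∈ chosen × Conflict m x

  open Scan

  Blocks : List (Fin n) → Fin n → Set
  Blocks ms v = Any.Any (λ m → Conflict m v) ms

  accept : ∀ {v vs} (s : Scan vs) → A v → ¬ Blocks (chosen s) v → Scan (v ∷ vs)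
  accept {v} s av unblocked = record
    { chosen  = v ∷ chosen s
    ; sound   = λ { (here refl) → av ; (there x∈) → sound s x∈ }
    ; free    = free′
    ; blocked = λ { (here refl) _ v∉ → ⊥-elim (v∉ (here refl))
                  ; (there x∈) ax x∉ → let (m , m∈ , m↯x) = blocked s x∈ ax (x∉ ∘ there)
                                       in m , there m∈ , m↯x }
    }
    where
    free′ : ∀ {x y} → x ∈ v ∷ chosen s → y ∈ v ∷ chosen s → x ≢ y → ¬ Conflict x y
    free′ (here refl) (here refl) x≢y   _   = x≢y refl
    free′ (here refl) (there y∈)  _     x↯y = unblocked (lose y∈ (conflict-sym x↯y))
    free′ (there x∈)  (here refl) _     x↯y = unblocked (lose x∈ x↯y)
    free′ (there x∈)  (there y∈)  x≢y       = free s x∈ y∈ x≢y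

  rejected-blocked : ∀ {v ms} → (¬ A v ⊎ Blocks ms v) → A v → ∃[ m ] m ∈ ms × Conflict m v
  rejected-blocked (inj₁ ¬av) av = ⊥-elim (¬av av)
  rejected-blocked (inj₂ hit) _  = find hit

  reject : ∀ {v vs} (s : Scan vs) → (¬ A v ⊎ Blocks (chosen s) v) → Scan (v ∷ vs)
  reject {v} s why = record
    { chosen  = chosen s
    ; sound   = sound s
    ; free    = free s
    ; blocked = blocked′
    }
    where
    blocked′ : ∀ {x} → x ∈ v ∷ _ → A x → x ∉ chosen s → ∃[ m ] m ∈ chosen s × Conflict m x
    blocked′ (here refl) av _ = rejected-blocked why av
    blocked′ (there x∈) ax x∉ = blocked s x∈ ax x∉

  scan : ∀ xs → Scan xs
  scan [] = record { chosen = [] ; sound = λ () ; free = λ () ; blocked = λ () }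
  scan (v ∷ vs) = step (scan vs) (A? v)
    where
    step : (s : Scan vs) → Dec (A v) → Scan (v ∷ vs)
    step s (no ¬av) = reject s (inj₁ ¬av)
    step s (yes av) with Any.any? (λ m → conflict? m v) (chosen s)
    ... | no unblocked = accept s av unblocked
    ... | yes hit      = reject s (inj₂ hit)

maximal-free-subset : ∀ {n} {A : Fin n → Set} → Decidable A →
  {Conflict : Fin n → Fin n → Set} → (∀ x y → Dec (Conflict x y)) →
  (∀ {x y} → Conflict x y → Conflict y x) → MaximalFreeSubset A Conflict
maximal-free-subset {n} A? conflict? conflict-sym = record
  { Member        = _∈ chosen
  ; member?       = λ x → DecMembership._∈?_ _≟_ x chosen
  ; member⇒A      = sound
  ; conflict-free = free
  ; maximal       = blocked (∈-allFin _)
  }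
  where open Greedy.Scan (Greedy.scan A? conflict? conflict-sym (allFin n))

another-element : ∀ {n} {xs : List (Fin n)} → Unique xs → 2 ≤ length xs →
  (u : Fin n) → ∃[ w ] w ∈ xs × w ≢ u
another-element {xs = []}        _ ()               _
another-element {xs = _ ∷ []}    _ (s≤s ())         _
another-element {xs = a ∷ b ∷ _} ((a≢b ∷ _) ∷ _) _ u with a ≟ u
... | no a≢u   = a , here refl , a≢u
... | yes refl = b , there (here refl) , λ b≡a → a≢b (≡-sym b≡a)

another-neighbour : ∀ {n} (G : SimpleGraph n) {v} → 2 ≤ degree G v →
  (u : Fin n) → ∃[ w ] Adj G v w × w ≢ u
another-neighbour {n} G {v} deg u =
  let (w , w∈ , w≢u) = another-element neighbours-unique deg u
  in w , proj₂ (∈-filter⁻ (adj? G v) {xs = allFin n} w∈) , w≢u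
  where
  neighbours-unique : Unique (filter (adj? G v) (allFin n))
  neighbours-unique = filter⁺ (adj? G v) (allFin⁺ n)

proper-rename : ∀ {n} {C D : Set} (G : SimpleGraph n) {c : Fin n → C} {f : C → D} →
  Injective _≡_ _≡_ f → Proper G c → Proper G (f ∘ c)
proper-rename G f-inj c-proper u v u~v = c-proper u v u~v ∘ f-inj

independent-B-rename : ∀ {n} {C D : Set} (G : SimpleGraph n) {c : Fin n → C} {f : C → D} →
  Injective _≡_ _≡_ f → Independent G (InB G c) → Independent G (InB G (f ∘ c))
independent-B-rename G f-inj B-indep u v (du , bu) (dv , bv) =
  B-indep u v (du , λ x y p q → f-inj (bu x y p q)) (dv , λ x y p q → f-inj (bv x y p q))

data Palette (k : ℕ) : Set where
  old   : Fin k → Palette k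
  X Y Z : Palette k

old-injective : ∀ {k} {i j : Fin k} → old i ≡ old j → i ≡ j
old-injective refl = refl

split : ∀ {k} → Palette k → Fin k ⊎ Fin 3
split (old i) = inj₁ i
split X       = inj₂ zero
split Y       = inj₂ (suc zero)
split Z       = inj₂ (suc (suc zero))

unsplit : ∀ {k} → Fin k ⊎ Fin 3 → Palette k
unsplit (inj₁ i)                 = old i
unsplit (inj₂ zero)              = X
unsplit (inj₂ (suc zero))        = Y
unsplit (inj₂ (suc (suc zero)))  = Z

unsplit-split : ∀ {k} (a : Palette k) → unsplit (split a) ≡ a
unsplit-split (old i) = refl
unsplit-split X       = refl
unsplit-split Y       = refl
unsplit-split Z       = refl

encode : ∀ {k} → Palette k → Fin (k + 3)
encode {k} = join k 3 ∘ split

decode : ∀ {k} → Fin (k + 3) → Palette k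
decode {k} = unsplit ∘ splitAt k

decode-encode : ∀ {k} (a : Palette k) → decode (encode a) ≡ a
decode-encode {k} a = trans (cong unsplit (splitAt-join k 3 (split a))) (unsplit-split a)

encode-injective : ∀ {k} → Injective _≡_ _≡_ (encode {k})
encode-injective {_} {a} {b} e = begin
  a                   ≡⟨ ≡-sym (decode-encode a) ⟩
  decode (encode a)   ≡⟨ cong decode e ⟩
  decode (encode b)   ≡⟨ decode-encode b ⟩
  b                   ∎
  where open ≡-Reasoning

module Recolouring {n k : ℕ} (G : SimpleGraph n) (c : Fin n → Fin k) (c-proper : Proper G c) where

  independent-set : MaximalFreeSubset (λ _ → ⊤) (Adj G)
  independent-set = maximal-free-subset (λ _ → yes tt) (adj? G) (sym G)

  open MaximalFreeSubset independent-set using ()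
    renaming (Member to S; member? to S?; conflict-free to S-free; maximal to S-maximal)

  S-independent : ∀ {u v} → S u → S v → ¬ Adj G u v
  S-independent {u} {v} su sv u~v with u ≟ v
  ... | yes refl = irrefl G u~v
  ... | no u≢v   = S-free su sv u≢v u~v

  S-dominating : ∀ {v} → ¬ S v → ∃[ s ] S s × Adj G s v
  S-dominating v∉S = S-maximal tt v∉S

  ShareOutsideNeighbour : Fin n → Fin n → Set
  ShareOutsideNeighbour s s′ = ∃[ t ] ¬ S t × Adj G s t × Adj G s′ t

  Q-subset : MaximalFreeSubset S ShareOutsideNeighbour
  Q-subset = maximal-free-subset S?
    (λ x y → any? λ t → ¬? (S? t) ×-dec adj? G x t ×-dec adj? G y t)
    (λ (t , t∉S , x~t , y~t) → t , t∉S , y~t , x~t)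

  open MaximalFreeSubset Q-subset using ()
    renaming (Member to Q; member? to Q?; member⇒A to Q⇒S; conflict-free to Q-free; maximal to Q-maximal)

  Saturated : Fin n → Set
  Saturated v = ∀ w → Adj G v w → S w × ¬ Q w

  saturated-at? : ∀ v w → Dec (Adj G v w → S w × ¬ Q w)
  saturated-at? v w = adj? G v w →-dec (S? w ×-dec ¬? (Q? w))

  Saturated? : Decidable Saturated
  Saturated? v = all? (saturated-at? v)

  unsaturated-witness : ∀ {v} → ¬ Saturated v → ∃[ w ] Adj G v w × (¬ S w ⊎ Q w)
  unsaturated-witness {v} unsat
    with ¬∀⟶∃¬ n _ (saturated-at? v) unsat
  ... | w , bad with adj? G v w | S? w | Q? w
  ...   | no ¬v~w | _        | _      = ⊥-elim (bad (⊥-elim ∘ ¬v~w))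
  ...   | yes v~w | no w∉S   | _      = w , v~w , inj₁ w∉S
  ...   | yes v~w | yes _    | yes wQ = w , v~w , inj₂ wQ
  ...   | yes _   | yes w∈S  | no w∉Q = ⊥-elim (bad λ _ → w∈S , w∉Q)

  data Class (v : Fin n) : Palette k → Set where
    in-Q      : Q v → Class v Z
    in-S∖Q    : S v → ¬ Q v → Class v X
    saturated : ¬ S v → Saturated v → Class v Y
    other     : ¬ S v → ¬ Saturated v → Class v (old (c v))

  -- Every vertex lies in exactly one class (Q is tested first, as Q ⊆ S).
  classify : ∀ v → Σ (Palette k) (Class v)
  classify v with Q? v | S? v | Saturated? v
  ... | yes vQ | _       | _       = Z , in-Q vQ
  ... | no v∉Q | yes v∈S | _       = X , in-S∖Q v∈S v∉Q
  ... | no _   | no v∉S  | yes sat = Y , saturated v∉S sat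
  ... | no _   | no v∉S  | no uns  = old (c v) , other v∉S uns

  colour : Fin n → Palette k
  colour = proj₁ ∘ classify

  class : ∀ v → Class v (colour v)
  class = proj₂ ∘ classify

  Q-is-Z : ∀ {v a} → Class v a → Q v → a ≡ Z
  Q-is-Z (in-Q _)          _  = refl
  Q-is-Z (in-S∖Q _ v∉Q)    vQ = ⊥-elim (v∉Q vQ)
  Q-is-Z (saturated v∉S _) vQ = ⊥-elim (v∉S (Q⇒S vQ))
  Q-is-Z (other v∉S _)     vQ = ⊥-elim (v∉S (Q⇒S vQ))

  S∖Q-is-X : ∀ {v a} → Class v a → S v → ¬ Q v → a ≡ X
  S∖Q-is-X (in-Q vQ)         _   v∉Q = ⊥-elim (v∉Q vQ)
  S∖Q-is-X (in-S∖Q _ _)      _   _   = refl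
  S∖Q-is-X (saturated v∉S _) v∈S _   = ⊥-elim (v∉S v∈S)
  S∖Q-is-X (other v∉S _)     v∈S _   = ⊥-elim (v∉S v∈S)

  saturated-is-Y : ∀ {v a} → Class v a → ¬ S v → Saturated v → a ≡ Y
  saturated-is-Y (in-Q vQ)       v∉S _   = ⊥-elim (v∉S (Q⇒S vQ))
  saturated-is-Y (in-S∖Q v∈S _)  v∉S _   = ⊥-elim (v∉S v∈S)
  saturated-is-Y (saturated _ _) _   _   = refl
  saturated-is-Y (other _ uns)   _   sat = ⊥-elim (uns sat)

  other-is-old : ∀ {v a} → Class v a → ¬ S v → ¬ Saturated v → a ≡ old (c v)
  other-is-old (in-Q vQ)         v∉S _   = ⊥-elim (v∉S (Q⇒S vQ))
  other-is-old (in-S∖Q v∈S _)    v∉S _   = ⊥-elim (v∉S v∈S)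
  other-is-old (saturated _ sat) _   uns = ⊥-elim (uns sat)
  other-is-old (other _ _)       _   _   = refl

  Z-is-Q : ∀ {v a} → Class v a → a ≡ Z → Q v
  Z-is-Q (in-Q vQ)       _  = vQ
  Z-is-Q (in-S∖Q _ _)    ()
  Z-is-Q (saturated _ _) ()
  Z-is-Q (other _ _)     ()

  S-separated : ∀ {u v a b} → Class u a → Class v b → S u → ¬ S v → a ≢ b
  S-separated (saturated u∉S _) _                  u∈S _   = ⊥-elim (u∉S u∈S)
  S-separated (other u∉S _)     _                  u∈S _   = ⊥-elim (u∉S u∈S)
  S-separated _                 (in-Q vQ)          _   v∉S = ⊥-elim (v∉S (Q⇒S vQ))
  S-separated _                 (in-S∖Q v∈S _)     _   v∉S = ⊥-elim (v∉S v∈S)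
  S-separated (in-Q _)          (saturated _ _)    _   _   = λ ()
  S-separated (in-Q _)          (other _ _)        _   _   = λ ()
  S-separated (in-S∖Q _ _)      (saturated _ _)    _   _   = λ ()
  S-separated (in-S∖Q _ _)      (other _ _)        _   _   = λ ()

  separated : ∀ {u v} → S u → ¬ S v → colour u ≢ colour v
  separated {u} {v} = S-separated (class u) (class v)

  -- The new colouring is proper: S is independent, S is separated from its
  -- complement, saturated vertices only see S, and elsewhere c is proper.
  proper : Proper G colour
  proper u v u~v = by-cases (S? u) (S? v)
    where
    -- Outside S, a saturated vertex would have its neighbour in S, so both
    -- ends keep their colour under c.
    outside-S : ¬ S u → ¬ S v → Dec (Saturated u) → Dec (Saturated v) → colour u ≢ colour v
    outside-S _   v∉S (yes u-sat) _           _    = v∉S (proj₁ (u-sat v u~v))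
    outside-S u∉S _   (no _)      (yes v-sat) _    = u∉S (proj₁ (v-sat u (sym G u~v)))
    outside-S u∉S v∉S (no u-uns)  (no v-uns)  same = c-proper u v u~v (old-injective (begin
      old (c u)  ≡⟨ ≡-sym (other-is-old (class u) u∉S u-uns) ⟩
      colour u   ≡⟨ same ⟩
      colour v   ≡⟨ other-is-old (class v) v∉S v-uns ⟩
      old (c v)  ∎))
      where open ≡-Reasoning

    by-cases : Dec (S u) → Dec (S v) → colour u ≢ colour v
    by-cases (yes u∈S) (yes v∈S) = λ _ → S-independent u∈S v∈S u~v
    by-cases (yes u∈S) (no v∉S)  = separated u∈S v∉S
    by-cases (no u∉S)  (yes v∈S) = separated v∈S u∉S ∘ ≡-sym
    by-cases (no u∉S)  (no v∉S)  = outside-S u∉S v∉S (Saturated? u) (Saturated? v)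

  S-edge-not-in-B : ∀ {u v} → S u → ¬ S v → Adj G u v →
    InB G colour u → InB G colour v → ⊥
  S-edge-not-in-B {u} {v} u∈S v∉S u~v (_ , same-at-u) (deg-v , same-at-v) =
    by-cases (Q? u) (Saturated? v)
    where
    -- v has a neighbour w ≠ u, coloured like u, i.e. Z; so w ∈ Q, and u, w
    -- share the neighbour v outside S, contradicting the choice of Q.
    u-in-Q : Q u → ⊥
    u-in-Q uQ =
      let (w , v~w , w≢u) = another-neighbour G deg-v u
          w-is-Z          = trans (same-at-v w u v~w (sym G u~v)) (Q-is-Z (class u) uQ)
          wQ              = Z-is-Q (class w) w-is-Z
      in Q-free uQ wQ (w≢u ∘ ≡-sym) (v , v∉S , u~v , sym G v~w)

    -- By maximality of Q, u shares a neighbour t ∉ S with some q ∈ Q; t sees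
    -- q ∈ Q so is not saturated, and colour t = old (c t) differs from colour v = Y.
    v-saturated : ¬ Q u → Saturated v → ⊥
    v-saturated u∉Q v-sat with Q-maximal u∈S u∉Q
    ... | q , qQ , t , t∉S , q~t , u~t = Y≢old (begin
      Y          ≡⟨ ≡-sym (saturated-is-Y (class v) v∉S v-sat) ⟩
      colour v   ≡⟨ same-at-u v t u~v u~t ⟩
      colour t   ≡⟨ other-is-old (class t) t∉S t-uns ⟩
      old (c t)  ∎)
      where
      open ≡-Reasoning
      t-uns : ¬ Saturated t
      t-uns t-sat = proj₂ (t-sat q (sym G q~t)) qQ
      Y≢old : ∀ {i} → Y ≢ old i
      Y≢old ()

    -- v has a neighbour w outside S ∖ Q, which must share u's colour X.
    v-unsaturated : ¬ Q u → ¬ Saturated v → ⊥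
    v-unsaturated u∉Q v-uns with unsaturated-witness v-uns
    ... | w , v~w , inj₁ w∉S = separated u∈S w∉S (same-at-v u w (sym G u~v) v~w)
    ... | w , v~w , inj₂ wQ  = X≢Z (begin
      X         ≡⟨ ≡-sym (S∖Q-is-X (class u) u∈S u∉Q) ⟩
      colour u  ≡⟨ same-at-v u w (sym G u~v) v~w ⟩
      colour w  ≡⟨ Q-is-Z (class w) wQ ⟩
      Z         ∎)
      where
      open ≡-Reasoning
      X≢Z : X ≢ Z
      X≢Z ()

    by-cases : Dec (Q u) → Dec (Saturated v) → ⊥
    by-cases (yes uQ)  _           = u-in-Q uQ
    by-cases (no u∉Q)  (yes v-sat) = v-saturated u∉Q v-sat
    by-cases (no u∉Q)  (no v-uns)  = v-unsaturated u∉Q v-uns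

  -- B is independent: within S by independence, across S by the lemma
  -- above, and outside S because u ∈ B sees S and thus v would be coloured
  -- like a vertex of S.
  B-independent : Independent G (InB G colour)
  B-independent u v Bu Bv u~v = by-cases (S? u) (S? v)
    where
    by-cases : Dec (S u) → Dec (S v) → ⊥
    by-cases (yes u∈S) (yes v∈S) = S-independent u∈S v∈S u~v
    by-cases (yes u∈S) (no v∉S)  = S-edge-not-in-B u∈S v∉S u~v Bu Bv
    by-cases (no u∉S)  (yes v∈S) = S-edge-not-in-B v∈S u∉S (sym G u~v) Bv Bu
    by-cases (no u∉S)  (no v∉S)  =
      let (s , s∈S , s~u) = S-dominating u∉S
      in separated s∈S v∉S (proj₂ Bu s v (sym G s~u) u~v)

recolour : ∀ {n k} (G : SimpleGraph n) → Colorable G k →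
  Σ (Fin n → Fin (k + 3)) (λ c′ → Proper G c′ × Independent G (InB G c′))
recolour G (c , c-proper) =
  encode ∘ colour ,
  proper-rename G encode-injective proper ,
  independent-B-rename G encode-injective B-independent
  where open Recolouring G c c-proper

lemma8 : (n : ℕ) (G : SimpleGraph n) (χ : ℕ) → IsChromaticNumber G χ →
    Σ (Fin n → Fin (χ + 3)) (λ c′ → Proper G c′ × Independent G (InB G c′))
lemma8 n G χ (χ-colourable , _) = recolour G χ-colourable
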